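{- There is a pair of orthogoval $\mathrm{PG}(3,\mathbb{F}_3)$.
   Context: $\mathrm{PG}(3,\mathbb{F}_3)$ is the $3$-dimensional projective space over the field with $3$ elements. A pair of spaces, both projective, of the same dimension and order and on the same point set (two incidence structures on a common point set, each isomorphic to the given space) are orthogoval if each line of one space intersects each line of the other space in at most two points. -}

module Defs where

open import Data.Bool using (Bool; true; false; _∧_; T)
open import Data.Nat using (ℕ; zero; suc; _<ᵇ_)
open import Data.Vec using (Vec; []; _∷_; zipWith; map)
open import Data.Product using (Σ; _×_; _,_)
open import Relation.Binary.PropositionalEquality using (_≡_)
open import Relation.Nullary using (¬_)
open import Data.Empty using (⊥)
open import Function.Bundles using (_↔_; Inverse)

data 𝔽₃ : Set where
  f0 f1 f2 : 𝔽₃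

_+₃_ : 𝔽₃ → 𝔽₃ → 𝔽₃
f0 +₃ y  = y
f1 +₃ f0 = f1
f1 +₃ f1 = f2
f1 +₃ f2 = f0
f2 +₃ f0 = f2
f2 +₃ f1 = f0
f2 +₃ f2 = f1

_*₃_ : 𝔽₃ → 𝔽₃ → 𝔽₃
f0 *₃ _  = f0
f1 *₃ y  = y
f2 *₃ f0 = f0
f2 *₃ f1 = f2
f2 *₃ f2 = f1

isZero₃ : 𝔽₃ → Bool
isZero₃ f0 = true
isZero₃ _  = false

V4 : Set
V4 = Vec 𝔽₃ 4

_⊕_ : ∀ {n} → Vec 𝔽₃ n → Vec 𝔽₃ n → Vec 𝔽₃ n
_⊕_ = zipWith _+₃_

_·_ : ∀ {n} → 𝔽₃ → Vec 𝔽₃ n → Vec 𝔽₃ n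
a · v = map (a *₃_) v

-- v is nonzero and its first nonzero coordinate equals 1
-- (canonical representative of a 1-dimensional subspace)
normalized : ∀ {n} → Vec 𝔽₃ n → Bool
normalized []        = false
normalized (f0 ∷ v)  = normalized v
normalized (f1 ∷ _)  = true
normalized (f2 ∷ _)  = false

pivot : ∀ {n} → Vec 𝔽₃ n → ℕ
pivot []       = zero
pivot (f0 ∷ v) = suc (pivot v)
pivot (_  ∷ _) = zero

zeroAt : ∀ {n} → Vec 𝔽₃ n → ℕ → Bool
zeroAt []      _       = true
zeroAt (x ∷ _) zero    = isZero₃ x
zeroAt (_ ∷ v) (suc i) = zeroAt v i

-- (u , w) is the reduced row echelon form of a rank-2 2×4 matrix
-- (canonical representative of a 2-dimensional subspace)
rref2 : V4 → V4 → Bool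
rref2 u w = normalized u ∧ normalized w ∧ (pivot u <ᵇ pivot w) ∧ zeroAt u (pivot w)

-- PG(3, 𝔽₃): points = 1-dim subspaces of 𝔽₃⁴, lines = 2-dim subspaces,
-- incidence = containment.

PGPoint : Set
PGPoint = Σ V4 (λ v → T (normalized v))

PGLine : Set
PGLine = Σ (V4 × V4) (λ { (u , w) → T (rref2 u w) })

_∈PG_ : PGPoint → PGLine → Set
(v , _) ∈PG ((u , w) , _) = Σ 𝔽₃ (λ a → Σ 𝔽₃ (λ b → v ≡ (a · u) ⊕ (b · w)))

record IncidenceStructure (X : Set) : Set₁ where
  field
    Line : Set
    _I_  : X → Line → Set

open IncidenceStructure public

IsoToPG33 : {X : Set} → IncidenceStructure X → Set
IsoToPG33 {X} S =
  Σ (X ↔ PGPoint) λ φ → Σ (Line S ↔ PGLine) λ ψ →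
    ∀ (x : X) (l : Line S) →
      (_I_ S x l → (Inverse.to φ x ∈PG Inverse.to ψ l)) ×
      ((Inverse.to φ x ∈PG Inverse.to ψ l) → _I_ S x l)

Orthogoval : {X : Set} → IncidenceStructure X → IncidenceStructure X → Set
Orthogoval {X} S₁ S₂ =
  ∀ (l₁ : Line S₁) (l₂ : Line S₂) (x y z : X) →
    _I_ S₁ x l₁ → _I_ S₂ x l₂ →
    _I_ S₁ y l₁ → _I_ S₂ y l₂ →
    _I_ S₁ z l₁ → _I_ S₂ z l₂ →
    ¬ (x ≡ y) → ¬ (x ≡ z) → ¬ (y ≡ z) → ⊥

-- Take S₁ = PG(3, 𝔽₃) and S₂ = its copy with the points relabelled by a permutation π;
-- orthogovality says that π maps no three distinct collinear points to collinear points.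
-- Any two distinct points of a line span it: their coefficients with respect to a
-- row-echelon basis of the line are distinct points of PG(1, 𝔽₃), hence a basis of 𝔽₃².
-- So it suffices that π r ∉ ⟨π p, π q⟩ for distinct points p, q, r of each line, which is
-- checked by evaluation for an explicit involution π.

module Submission where

open import Defs
open import Data.Bool using (T)
open import Data.Bool.Properties using (T-∧; T-irrelevant)
open import Data.Empty using (⊥-elim)
open import Data.List using (List; []; _∷_; cartesianProductWith)
open import Data.List.Membership.Propositional using (_∈_; lose)
open import Data.List.Membership.Propositional.Properties using (∈-cartesianProductWith⁺)
open import Data.List.Relation.Unary.All as All using (all?)
open import Data.List.Relation.Unary.Any as Any using (here; there; any?)
open import Data.Nat using (zero; suc; _<ᵇ_)
open import Data.Product using (Σ; _×_; _,_; proj₁)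
open import Data.Unit using (tt)
open import Data.Vec using (Vec; []; _∷_)
import Data.Vec.Properties as Vec
open import Function using (id; _∘_)
open import Function.Bundles using (mk↔ₛ′; Equivalence)
open import Function.Construct.Identity using (↔-id)
open import Relation.Binary.Definitions using (DecidableEquality)
open import Relation.Binary.PropositionalEquality using (_≡_; _≢_; refl; sym; trans; cong; cong₂; module ≡-Reasoning)
open import Relation.Nullary using (Dec; yes; no; ¬_)
open import Relation.Nullary.Decidable using (map′; from-yes; T?; ¬?; _→-dec_)
open import Relation.Unary using (Decidable)

_≟₃_ : DecidableEquality 𝔽₃
f0 ≟₃ f0 = yes refl
f1 ≟₃ f1 = yes refl
f2 ≟₃ f2 = yes refl
f0 ≟₃ f1 = no λ ()
f0 ≟₃ f2 = no λ ()
f1 ≟₃ f0 = no λ ()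
f1 ≟₃ f2 = no λ ()
f2 ≟₃ f0 = no λ ()
f2 ≟₃ f1 = no λ ()

_≟ᵥ_ : ∀ {n} → DecidableEquality (Vec 𝔽₃ n)
_≟ᵥ_ = Vec.≡-dec _≟₃_

𝔽₃-elements : List 𝔽₃
𝔽₃-elements = f0 ∷ f1 ∷ f2 ∷ []

∈-𝔽₃-elements : ∀ a → a ∈ 𝔽₃-elements
∈-𝔽₃-elements f0 = here refl
∈-𝔽₃-elements f1 = there (here refl)
∈-𝔽₃-elements f2 = there (there (here refl))

vectors : ∀ n → List (Vec 𝔽₃ n)
vectors zero    = [] ∷ []
vectors (suc n) = cartesianProductWith _∷_ 𝔽₃-elements (vectors n)

∈-vectors : ∀ {n} (v : Vec 𝔽₃ n) → v ∈ vectors n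
∈-vectors []      = here refl
∈-vectors (a ∷ v) = ∈-cartesianProductWith⁺ _∷_ (∈-𝔽₃-elements a) (∈-vectors v)

module _ {A : Set} {xs : List A} (complete : ∀ x → x ∈ xs) where

  all-complete? : {P : A → Set} → Decidable P → Dec (∀ x → P x)
  all-complete? P? =
    map′ (λ ps x → All.lookup ps (complete x)) (λ ps → All.tabulate λ {x} _ → ps x) (all? P? xs)

  any-complete? : {P : A → Set} → Decidable P → Dec (Σ A P)
  any-complete? P? = map′ Any.satisfied (λ (x , px) → lose (complete x) px) (any? P? xs)

∀₃? : {P : 𝔽₃ → Set} → Decidable P → Dec (∀ a → P a)
∀₃? = all-complete? ∈-𝔽₃-elements

∃₃? : {P : 𝔽₃ → Set} → Decidable P → Dec (Σ 𝔽₃ P)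
∃₃? = any-complete? ∈-𝔽₃-elements

∀ᵥ? : ∀ {n} {P : Vec 𝔽₃ n → Set} → Decidable P → Dec (∀ v → P v)
∀ᵥ? = all-complete? ∈-vectors

_∈⟨_,_⟩ : ∀ {n} → Vec 𝔽₃ n → Vec 𝔽₃ n → Vec 𝔽₃ n → Set
v ∈⟨ u , w ⟩ = Σ 𝔽₃ λ a → Σ 𝔽₃ λ b → v ≡ (a · u) ⊕ (b · w)

_∈⟨_,_⟩? : ∀ {n} (v u w : Vec 𝔽₃ n) → Dec (v ∈⟨ u , w ⟩)
v ∈⟨ u , w ⟩? = ∃₃? λ a → ∃₃? λ b → v ≟ᵥ ((a · u) ⊕ (b · w))

*₃-zeroʳ : ∀ a → a *₃ f0 ≡ f0
*₃-zeroʳ f0 = refl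
*₃-zeroʳ f1 = refl
*₃-zeroʳ f2 = refl

-- Proofs by evaluation are opaque: unfolding their proof terms during conversion
-- checking is prohibitively expensive.
opaque
  combination-bilinear-coordinate : ∀ g h a b c d x y →
    (g *₃ ((a *₃ x) +₃ (b *₃ y))) +₃ (h *₃ ((c *₃ x) +₃ (d *₃ y))) ≡
    (((g *₃ a) +₃ (h *₃ c)) *₃ x) +₃ (((g *₃ b) +₃ (h *₃ d)) *₃ y)
  combination-bilinear-coordinate = from-yes
    (∀₃? λ g → ∀₃? λ h → ∀₃? λ a → ∀₃? λ b → ∀₃? λ c → ∀₃? λ d → ∀₃? λ x → ∀₃? λ y →
      ((g *₃ ((a *₃ x) +₃ (b *₃ y))) +₃ (h *₃ ((c *₃ x) +₃ (d *₃ y))))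
        ≟₃ ((((g *₃ a) +₃ (h *₃ c)) *₃ x) +₃ (((g *₃ b) +₃ (h *₃ d)) *₃ y)))

combination-bilinear : ∀ {n} g h a b c d (u w : Vec 𝔽₃ n) →
  (g · ((a · u) ⊕ (b · w))) ⊕ (h · ((c · u) ⊕ (d · w))) ≡
  (((g *₃ a) +₃ (h *₃ c)) · u) ⊕ (((g *₃ b) +₃ (h *₃ d)) · w)
combination-bilinear g h a b c d []      []      = refl
combination-bilinear g h a b c d (x ∷ u) (y ∷ w) =
  cong₂ _∷_ (combination-bilinear-coordinate g h a b c d x y) (combination-bilinear g h a b c d u w)

f0·u⊕v≡v : ∀ {n} (u v : Vec 𝔽₃ n) → (f0 · u) ⊕ v ≡ v
f0·u⊕v≡v []      []      = refl
f0·u⊕v≡v (_ ∷ u) (y ∷ v) = cong (y ∷_) (f0·u⊕v≡v u v)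

zero-multiple-not-normalized : ∀ {n} (w : Vec 𝔽₃ n) → ¬ T (normalized (f0 · w))
zero-multiple-not-normalized []      ()
zero-multiple-not-normalized (_ ∷ w) = zero-multiple-not-normalized w

normalized-multiple⇒f1 : ∀ {n} (w : Vec 𝔽₃ n) b → T (normalized w) → T (normalized (b · w)) → b ≡ f1
normalized-multiple⇒f1 (f0 ∷ w) b nw nbw rewrite *₃-zeroʳ b = normalized-multiple⇒f1 w b nw nbw
normalized-multiple⇒f1 (f1 ∷ w) f0 _ nbw = ⊥-elim (zero-multiple-not-normalized w nbw)
normalized-multiple⇒f1 (f1 ∷ w) f1 _ _   = refl

record RowEchelon {n} (u w : Vec 𝔽₃ n) : Set where
  constructor rowEchelon
  field
    u-normalized : T (normalized u)
    w-normalized : T (normalized w)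
    pivot<pivot  : T (pivot u <ᵇ pivot w)

rref2⇒RowEchelon : ∀ {u w} → T (rref2 u w) → RowEchelon u w
rref2⇒RowEchelon r =
  let nu , r′ = Equivalence.to T-∧ r
      nw , r″ = Equivalence.to T-∧ r′
  in rowEchelon nu nw (proj₁ (Equivalence.to T-∧ r″))

echelon-coefficients-normalized : ∀ {n} {u w : Vec 𝔽₃ n} a b → RowEchelon u w →
  T (normalized ((a · u) ⊕ (b · w))) → T (normalized (a ∷ b ∷ []))
echelon-coefficients-normalized {u = f0 ∷ u} {f0 ∷ w} a b (rowEchelon nu nw u<w) nc
  rewrite *₃-zeroʳ a | *₃-zeroʳ b =
  echelon-coefficients-normalized a b (rowEchelon {u = u} {w} nu nw u<w) nc
echelon-coefficients-normalized {u = f1 ∷ u} {f0 ∷ w} f0 b (rowEchelon _ nw _) nc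
  rewrite *₃-zeroʳ b | f0·u⊕v≡v u (b · w) | normalized-multiple⇒f1 w b nw nc = tt
echelon-coefficients-normalized {u = f1 ∷ u} {f0 ∷ w} f1 b _ _ = tt
echelon-coefficients-normalized {u = f1 ∷ u} {f0 ∷ w} f2 b _ nc rewrite *₃-zeroʳ b = ⊥-elim nc

opaque
  distinct-points-span-𝔽₃² : ∀ (p q v : Vec 𝔽₃ 2) →
    T (normalized p) → T (normalized q) → p ≢ q → v ∈⟨ p , q ⟩
  distinct-points-span-𝔽₃² = from-yes
    (∀ᵥ? {2} λ p → ∀ᵥ? {2} λ q → ∀ᵥ? {2} λ v →
      T? (normalized p) →-dec T? (normalized q) →-dec ¬? (p ≟ᵥ q) →-dec v ∈⟨ p , q ⟩?)

combination : ∀ {n} → Vec 𝔽₃ n → Vec 𝔽₃ n → Vec 𝔽₃ 2 → Vec 𝔽₃ n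
combination u w (a ∷ b ∷ []) = (a · u) ⊕ (b · w)

echelon-spanned-by-two-points : ∀ {n} {u w p q v : Vec 𝔽₃ n} → RowEchelon u w →
  T (normalized p) → T (normalized q) → p ≢ q →
  p ∈⟨ u , w ⟩ → q ∈⟨ u , w ⟩ → v ∈⟨ u , w ⟩ → v ∈⟨ p , q ⟩
echelon-spanned-by-two-points {u = u} {w} ech np nq p≢q (a , b , refl) (c , d , refl) (e , f , refl) =
  let g , h , ef≡ = distinct-points-span-𝔽₃² (a ∷ b ∷ []) (c ∷ d ∷ []) (e ∷ f ∷ [])
                      (echelon-coefficients-normalized a b ech np) (echelon-coefficients-normalized c d ech nq)
                      (λ ab≡cd → p≢q (cong (combination u w) ab≡cd))
  in g , h , (begin
      (e · u) ⊕ (f · w)                                           ≡⟨ cong (combination u w) ef≡ ⟩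
      (((g *₃ a) +₃ (h *₃ c)) · u) ⊕ (((g *₃ b) +₃ (h *₃ d)) · w) ≡⟨ sym (combination-bilinear g h a b c d u w) ⟩
      (g · ((a · u) ⊕ (b · w))) ⊕ (h · ((c · u) ⊕ (d · w)))       ∎)
  where open ≡-Reasoning

PGPoint-≡ : {x y : PGPoint} → proj₁ x ≡ proj₁ y → x ≡ y
PGPoint-≡ {v , p} {.v , q} refl = cong (v ,_) (T-irrelevant p q)

line-spanned-by-two-points : (l : PGLine) (x y z : PGPoint) →
  x ∈PG l → y ∈PG l → z ∈PG l → x ≢ y → proj₁ z ∈⟨ proj₁ x , proj₁ y ⟩
line-spanned-by-two-points (_ , r) (_ , nx) (_ , ny) _ x∈l y∈l z∈l x≢y =
  echelon-spanned-by-two-points (rref2⇒RowEchelon r) nx ny (x≢y ∘ PGPoint-≡) x∈l y∈l z∈l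

-- A fixed-point-free involution of the 40 points, found by a local search.
π : V4 → V4
π (f0 ∷ f0 ∷ f0 ∷ f1 ∷ []) = f1 ∷ f0 ∷ f0 ∷ f2 ∷ []
π (f0 ∷ f0 ∷ f1 ∷ f0 ∷ []) = f1 ∷ f0 ∷ f2 ∷ f1 ∷ []
π (f0 ∷ f0 ∷ f1 ∷ f1 ∷ []) = f1 ∷ f0 ∷ f0 ∷ f0 ∷ []
π (f0 ∷ f0 ∷ f1 ∷ f2 ∷ []) = f1 ∷ f2 ∷ f2 ∷ f0 ∷ []
π (f0 ∷ f1 ∷ f0 ∷ f0 ∷ []) = f1 ∷ f2 ∷ f1 ∷ f1 ∷ []
π (f0 ∷ f1 ∷ f0 ∷ f1 ∷ []) = f1 ∷ f1 ∷ f1 ∷ f0 ∷ []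
π (f0 ∷ f1 ∷ f0 ∷ f2 ∷ []) = f1 ∷ f0 ∷ f0 ∷ f1 ∷ []
π (f0 ∷ f1 ∷ f1 ∷ f0 ∷ []) = f1 ∷ f1 ∷ f0 ∷ f0 ∷ []
π (f0 ∷ f1 ∷ f1 ∷ f1 ∷ []) = f0 ∷ f1 ∷ f1 ∷ f2 ∷ []
π (f0 ∷ f1 ∷ f1 ∷ f2 ∷ []) = f0 ∷ f1 ∷ f1 ∷ f1 ∷ []
π (f0 ∷ f1 ∷ f2 ∷ f0 ∷ []) = f1 ∷ f0 ∷ f1 ∷ f1 ∷ []
π (f0 ∷ f1 ∷ f2 ∷ f1 ∷ []) = f1 ∷ f2 ∷ f1 ∷ f0 ∷ []
π (f0 ∷ f1 ∷ f2 ∷ f2 ∷ []) = f1 ∷ f0 ∷ f1 ∷ f2 ∷ []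
π (f1 ∷ f0 ∷ f0 ∷ f0 ∷ []) = f0 ∷ f0 ∷ f1 ∷ f1 ∷ []
π (f1 ∷ f0 ∷ f0 ∷ f1 ∷ []) = f0 ∷ f1 ∷ f0 ∷ f2 ∷ []
π (f1 ∷ f0 ∷ f0 ∷ f2 ∷ []) = f0 ∷ f0 ∷ f0 ∷ f1 ∷ []
π (f1 ∷ f0 ∷ f1 ∷ f0 ∷ []) = f1 ∷ f2 ∷ f2 ∷ f2 ∷ []
π (f1 ∷ f0 ∷ f1 ∷ f1 ∷ []) = f0 ∷ f1 ∷ f2 ∷ f0 ∷ []
π (f1 ∷ f0 ∷ f1 ∷ f2 ∷ []) = f0 ∷ f1 ∷ f2 ∷ f2 ∷ []
π (f1 ∷ f0 ∷ f2 ∷ f0 ∷ []) = f1 ∷ f1 ∷ f1 ∷ f1 ∷ []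
π (f1 ∷ f0 ∷ f2 ∷ f1 ∷ []) = f0 ∷ f0 ∷ f1 ∷ f0 ∷ []
π (f1 ∷ f0 ∷ f2 ∷ f2 ∷ []) = f1 ∷ f1 ∷ f2 ∷ f2 ∷ []
π (f1 ∷ f1 ∷ f0 ∷ f0 ∷ []) = f0 ∷ f1 ∷ f1 ∷ f0 ∷ []
π (f1 ∷ f1 ∷ f0 ∷ f1 ∷ []) = f1 ∷ f2 ∷ f1 ∷ f2 ∷ []
π (f1 ∷ f1 ∷ f0 ∷ f2 ∷ []) = f1 ∷ f1 ∷ f2 ∷ f1 ∷ []
π (f1 ∷ f1 ∷ f1 ∷ f0 ∷ []) = f0 ∷ f1 ∷ f0 ∷ f1 ∷ []
π (f1 ∷ f1 ∷ f1 ∷ f1 ∷ []) = f1 ∷ f0 ∷ f2 ∷ f0 ∷ []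
π (f1 ∷ f1 ∷ f1 ∷ f2 ∷ []) = f1 ∷ f2 ∷ f0 ∷ f2 ∷ []
π (f1 ∷ f1 ∷ f2 ∷ f0 ∷ []) = f1 ∷ f2 ∷ f2 ∷ f1 ∷ []
π (f1 ∷ f1 ∷ f2 ∷ f1 ∷ []) = f1 ∷ f1 ∷ f0 ∷ f2 ∷ []
π (f1 ∷ f1 ∷ f2 ∷ f2 ∷ []) = f1 ∷ f0 ∷ f2 ∷ f2 ∷ []
π (f1 ∷ f2 ∷ f0 ∷ f0 ∷ []) = f1 ∷ f2 ∷ f0 ∷ f1 ∷ []
π (f1 ∷ f2 ∷ f0 ∷ f1 ∷ []) = f1 ∷ f2 ∷ f0 ∷ f0 ∷ []
π (f1 ∷ f2 ∷ f0 ∷ f2 ∷ []) = f1 ∷ f1 ∷ f1 ∷ f2 ∷ []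
π (f1 ∷ f2 ∷ f1 ∷ f0 ∷ []) = f0 ∷ f1 ∷ f2 ∷ f1 ∷ []
π (f1 ∷ f2 ∷ f1 ∷ f1 ∷ []) = f0 ∷ f1 ∷ f0 ∷ f0 ∷ []
π (f1 ∷ f2 ∷ f1 ∷ f2 ∷ []) = f1 ∷ f1 ∷ f0 ∷ f1 ∷ []
π (f1 ∷ f2 ∷ f2 ∷ f0 ∷ []) = f0 ∷ f0 ∷ f1 ∷ f2 ∷ []
π (f1 ∷ f2 ∷ f2 ∷ f1 ∷ []) = f1 ∷ f1 ∷ f2 ∷ f0 ∷ []
π (f1 ∷ f2 ∷ f2 ∷ f2 ∷ []) = f1 ∷ f0 ∷ f1 ∷ f0 ∷ []
π v = v

opaque
  π-involutive : ∀ v → π (π v) ≡ v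
  π-involutive = from-yes (∀ᵥ? {4} λ v → π (π v) ≟ᵥ v)

opaque
  π-normalized : ∀ v → T (normalized v) → T (normalized (π v))
  π-normalized = from-yes (∀ᵥ? {4} λ v → T? (normalized v) →-dec T? (normalized (π v)))

πᴾ : PGPoint → PGPoint
πᴾ (v , nv) = π v , π-normalized v nv

πᴾ-involutive : ∀ x → πᴾ (πᴾ x) ≡ x
πᴾ-involutive (v , _) = PGPoint-≡ (π-involutive v)

πᴾ-injective : ∀ {x y} → πᴾ x ≡ πᴾ y → x ≡ y
πᴾ-injective {x} {y} πx≡πy =
  trans (sym (πᴾ-involutive x)) (trans (cong πᴾ πx≡πy) (πᴾ-involutive y))

ImageNotCollinear : V4 → V4 → V4 → Set
ImageNotCollinear p q r =
  T (normalized p) → T (normalized q) → T (normalized r) →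
  p ≢ q → p ≢ r → q ≢ r → ¬ (π r ∈⟨ π p , π q ⟩)

imageNotCollinear? : ∀ p q r → Dec (ImageNotCollinear p q r)
imageNotCollinear? p q r =
  T? (normalized p) →-dec T? (normalized q) →-dec T? (normalized r) →-dec
  ¬? (p ≟ᵥ q) →-dec ¬? (p ≟ᵥ r) →-dec ¬? (q ≟ᵥ r) →-dec ¬? (π r ∈⟨ π p , π q ⟩?)

opaque
  π-breaks-collinear-combinations : ∀ u w → T (rref2 u w) → ∀ a₁ b₁ a₂ b₂ a₃ b₃ →
    ImageNotCollinear ((a₁ · u) ⊕ (b₁ · w)) ((a₂ · u) ⊕ (b₂ · w)) ((a₃ · u) ⊕ (b₃ · w))
  π-breaks-collinear-combinations = from-yes
    (∀ᵥ? {4} λ u → ∀ᵥ? {4} λ w → T? (rref2 u w) →-dec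
      ∀₃? λ a₁ → ∀₃? λ b₁ → ∀₃? λ a₂ → ∀₃? λ b₂ → ∀₃? λ a₃ → ∀₃? λ b₃ →
      imageNotCollinear? ((a₁ · u) ⊕ (b₁ · w)) ((a₂ · u) ⊕ (b₂ · w)) ((a₃ · u) ⊕ (b₃ · w)))

π-breaks-collinear-triples : (l : PGLine) (x y z : PGPoint) →
  x ∈PG l → y ∈PG l → z ∈PG l → x ≢ y → x ≢ z → y ≢ z →
  ¬ (proj₁ (πᴾ z) ∈⟨ proj₁ (πᴾ x) , proj₁ (πᴾ y) ⟩)
π-breaks-collinear-triples ((u , w) , r) (_ , nx) (_ , ny) (_ , nz)
  (a₁ , b₁ , refl) (a₂ , b₂ , refl) (a₃ , b₃ , refl) x≢y x≢z y≢z =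
  π-breaks-collinear-combinations u w r a₁ b₁ a₂ b₂ a₃ b₃ nx ny nz
    (x≢y ∘ PGPoint-≡) (x≢z ∘ PGPoint-≡) (y≢z ∘ PGPoint-≡)

PG : IncidenceStructure PGPoint
PG = record { Line = PGLine ; _I_ = _∈PG_ }

PGπ : IncidenceStructure PGPoint
PGπ = record { Line = PGLine ; _I_ = λ x l → πᴾ x ∈PG l }

PG-iso : IsoToPG33 PG
PG-iso = ↔-id _ , ↔-id _ , λ _ _ → id , id

PGπ-iso : IsoToPG33 PGπ
PGπ-iso = mk↔ₛ′ πᴾ πᴾ πᴾ-involutive πᴾ-involutive , ↔-id _ , λ _ _ → id , id

PG-orthogoval-PGπ : Orthogoval PG PGπ
PG-orthogoval-PGπ l₁ l₂ x y z x∈l₁ πx∈l₂ y∈l₁ πy∈l₂ z∈l₁ πz∈l₂ x≢y x≢z y≢z =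
  π-breaks-collinear-triples l₁ x y z x∈l₁ y∈l₁ z∈l₁ x≢y x≢z y≢z
    (line-spanned-by-two-points l₂ (πᴾ x) (πᴾ y) (πᴾ z) πx∈l₂ πy∈l₂ πz∈l₂ (x≢y ∘ πᴾ-injective))

mainTheorem14 : Σ Set λ X → Σ (IncidenceStructure X) λ S₁ → Σ (IncidenceStructure X) λ S₂ →
    IsoToPG33 S₁ × IsoToPG33 S₂ × Orthogoval S₁ S₂
mainTheorem14 = PGPoint , PG , PGπ , PG-iso , PGπ-iso , PG-orthogoval-PGπ
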